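{- Let $i,j \geq 2$ be integers. If the phylogeny graph of an $(i,j)$ digraph contains an induced subgraph isomorphic to the fan $P_\ell \vee I_1$ or the wheel $C_\ell \vee I_1$ for some positive integer $\ell$, then $\ell \leq 2j+2$. Furthermore, both $P_{2j+2}\vee I_1$ and $C_{2j+2}\vee I_1$ are $(i,j)$ realizable, i.e. each is isomorphic to an induced subgraph of the phylogeny graph of some $(i,j)$ digraph.
   Context: An $(i,j)$ digraph is an acyclic digraph in which every vertex has indegree at most $i$ and outdegree at most $j$. The phylogeny graph $P(D)$ has vertex set $V(D)$ and an edge between distinct $u,v$ iff $(u,v)\in A(D)$ or $(v,u)\in A(D)$ or $u,v$ have a common out-neighbor in $D$. $P_\ell$ is the path on $\ell$ vertices, $C_\ell$ the cycle on $\ell$ vertices, $I_1$ the one-vertex graph, and $G\vee H$ the join of disjoint graphs (their union plus all edges between $V(G)$ and $V(H)$). -}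

module Defs where

open import Data.Nat using (ℕ; zero; suc; _+_; _≤_)
open import Data.Fin using (Fin; toℕ) renaming (zero to fz; suc to fs)
open import Data.Bool using (Bool; true; false; if_then_else_)
open import Data.List using (List; map)
open import Data.Nat.ListAction using (sum)
open import Data.List using () renaming (allFin to allFinL)
open import Data.Product using (Σ; _×_; ∃)
open import Data.Sum using (_⊎_)
open import Data.Empty using (⊥)
open import Data.Unit using (⊤)
open import Relation.Nullary using (¬_)
open import Relation.Binary.PropositionalEquality using (_≡_; _≢_)
open import Function.Definitions using (Injective)

record Digraph : Set where
  field
    size : ℕ
    arc  : Fin size → Fin size → Bool

open Digraph public

Arc : (D : Digraph) → Fin (size D) → Fin (size D) → Set
Arc D u v = arc D u v ≡ true

data Walk (D : Digraph) : Fin (size D) → Fin (size D) → Set where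
  step : ∀ {u v} → Arc D u v → Walk D u v
  _∷w_ : ∀ {u v w} → Arc D u v → Walk D v w → Walk D u w

Acyclic : Digraph → Set
Acyclic D = ∀ v → ¬ Walk D v v

b2n : Bool → ℕ
b2n true = 1
b2n false = 0

indeg : (D : Digraph) → Fin (size D) → ℕ
indeg D v = sum (map (λ u → b2n (arc D u v)) (allFinL (size D)))

outdeg : (D : Digraph) → Fin (size D) → ℕ
outdeg D u = sum (map (λ v → b2n (arc D u v)) (allFinL (size D)))

IJDigraph : ℕ → ℕ → Digraph → Set
IJDigraph i j D = Acyclic D × (∀ v → indeg D v ≤ i) × (∀ v → outdeg D v ≤ j)

PhyloAdj : (D : Digraph) → Fin (size D) → Fin (size D) → Set
PhyloAdj D u v = u ≢ v × (Arc D u v ⊎ Arc D v u ⊎ ∃ λ w → Arc D u w × Arc D v w)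

-- A simple graph on Fin m given by an adjacency relation (only used on distinct pairs).
Graph : ℕ → Set₁
Graph m = Fin m → Fin m → Set

InducedSubgraph : ∀ {m n} → Graph m → Graph n → Set
InducedSubgraph {m} {n} H G =
  Σ (Fin m → Fin n) λ f → Injective _≡_ _≡_ f ×
    (∀ a b → a ≢ b → (H a b → G (f a) (f b)) × (G (f a) (f b) → H a b))

PathAdj : (ℓ : ℕ) → Graph ℓ
PathAdj ℓ a b = (suc (toℕ a) ≡ toℕ b) ⊎ (suc (toℕ b) ≡ toℕ a)

CycleAdj : (ℓ : ℕ) → Graph ℓ
CycleAdj ℓ a b = PathAdj ℓ a b
  ⊎ (toℕ a ≡ 0 × suc (toℕ b) ≡ ℓ) ⊎ (toℕ b ≡ 0 × suc (toℕ a) ≡ ℓ)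

JoinI1 : ∀ {m} → Graph m → Graph (suc m)
JoinI1 G fz fz = ⊥
JoinI1 G fz (fs _) = ⊤
JoinI1 G (fs _) fz = ⊤
JoinI1 G (fs a) (fs b) = G a b

Fan : (ℓ : ℕ) → Graph (suc ℓ)
Fan ℓ = JoinI1 (PathAdj ℓ)

Wheel : (ℓ : ℕ) → Graph (suc ℓ)
Wheel ℓ = JoinI1 (CycleAdj ℓ)

Realizable : ℕ → ℕ → ∀ {m} → Graph m → Set
Realizable i j H = Σ Digraph λ D → IJDigraph i j D × InducedSubgraph H (PhyloAdj D)

{-# OPTIONS --safe #-}
-- Let c be the hub of an induced P_ℓ ∨ I₁ or C_ℓ ∨ I₁ in P(D).  Each rim vertex y is adjacent to c
-- in P(D), i.e. c and y reach a common vertex a in at most one step, and then a ∈ {c} ∪ N⁺(c), a set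
-- of at most j + 1 vertices.  Rim vertices sharing such an a are adjacent in P(D); for ℓ ≥ 4 the rim
-- is triangle-free, so each a serves at most two rim vertices and ℓ ≤ 2j + 2.  The realizing
-- digraph uses each of the j + 1 meeting points exactly twice.

module Submission where

open import Defs
open import Data.Nat using (ℕ; _≤_; _+_; _*_)
open import Data.Product using (_×_)
open import Data.Sum using (_⊎_)

open import Data.Nat using (zero; suc; _<_; z≤n; s≤s; _≤?_)
open import Data.Nat.Properties
  using ( module ≤-Reasoning; ≤-refl; ≤-reflexive; ≤-trans; <-irrefl; <-trans; n<1+n; ≰⇒>; <⇒≱
        ; +-suc; +-mono-≤; +-monoˡ-≤; *-monoˡ-≤; *-monoʳ-≤; *-identityʳ)
  renaming (_≟_ to _≟ℕ_)
open import Data.Nat.Tactic.RingSolver using (solve-∀)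
open import Data.Nat.ListAction using (sum)
open import Data.Fin using (Fin; toℕ; fromℕ<) renaming (zero to fz; suc to fs)
open import Data.Fin.Properties
  using (toℕ-injective; toℕ<n; fromℕ<-toℕ; toℕ-fromℕ<; suc-injective)
  renaming (_≟_ to _≟Fin_)
open import Data.Bool using (Bool; true; false)
open import Data.Bool.Properties using () renaming (_≟_ to _≟Bool_)
open import Data.List using (List; []; _∷_; length; map; filter; allFin; applyUpTo)
open import Data.List.Properties using (length-tabulate; length-applyUpTo)
open import Data.List.Relation.Unary.All as All using (All; []; _∷_)
open import Data.List.Relation.Unary.All.Properties
  using (all-filter; tabulate⁺) renaming (filter⁺ to All-filter⁺)
open import Data.List.Relation.Unary.Any using (here; there)
open import Data.List.Relation.Unary.AllPairs using ([]; _∷_)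
open import Data.List.Relation.Unary.Unique.Propositional using (Unique)
import Data.List.Relation.Unary.Unique.Propositional.Properties as Unique
open import Data.List.Membership.Propositional using (_∈_)
open import Data.List.Membership.Propositional.Properties
  using (∈-filter⁺; ∈-allFin; ∈-applyUpTo⁺; ∈-applyUpTo⁻)
open import Data.List.Membership.DecPropositional _≟ℕ_ using (_∈?_)
open import Data.Product using (∃; _,_; proj₁; proj₂)
open import Data.Sum using (inj₁; inj₂)
open import Data.Empty using (⊥; ⊥-elim)
open import Data.Unit using (tt)
open import Function using (_∘_; const)
open import Function.Definitions using (Injective)
open import Relation.Binary.Definitions using (DecidableEquality)
open import Relation.Binary.Construct.Closure.Reflexive as Refl using (ReflClosure; refl; [_])
open import Relation.Binary.PropositionalEquality
  using (_≡_; _≢_; refl; sym; trans; cong; subst; subst₂)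
open import Relation.Nullary using (Dec; yes; no; does; proof; Reflects; invert)
open import Relation.Nullary.Decidable using (map′; dec-true; _×-dec_; _⊎-dec_)
open import Level using (0ℓ)
open import Relation.Unary using (Pred; Decidable)
open import Relation.Unary.Properties using (∁?)

module _ {A : Set} where

  length-filter-split : {P : Pred A 0ℓ} (P? : Decidable P) (xs : List A) →
    length xs ≡ length (filter P? xs) + length (filter (∁? P?) xs)
  length-filter-split P? [] = refl
  length-filter-split P? (x ∷ xs) with does (P? x)
  ... | true  = cong suc (length-filter-split P? xs)
  ... | false = trans (cong suc (length-filter-split P? xs)) (sym (+-suc _ _))

  sum-b2n≡length-filter : (g : A → Bool) (xs : List A) →
    sum (map (λ x → b2n (g x)) xs) ≡ length (filter (λ x → g x ≟Bool true) xs)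
  sum-b2n≡length-filter g [] = refl
  sum-b2n≡length-filter g (x ∷ xs) with g x
  ... | true  = cong suc (sum-b2n≡length-filter g xs)
  ... | false = sum-b2n≡length-filter g xs

module _ {A B : Set} (label : A → B) where

  FibresAtMost : ℕ → Set
  FibresAtMost k = ∀ b {xs} → Unique xs → All (λ x → label x ≡ b) xs → length xs ≤ k

  injective⇒fibresAtMost1 : Injective _≡_ _≡_ label → FibresAtMost 1
  injective⇒fibresAtMost1 _ _ {[]} _ _ = z≤n
  injective⇒fibresAtMost1 _ _ {_ ∷ []} _ _ = s≤s z≤n
  injective⇒fibresAtMost1 inj _ {_ ∷ _ ∷ _} ((x≢y ∷ _) ∷ _) (lx ∷ ly ∷ _) =
    ⊥-elim (x≢y (inj (trans lx (sym ly))))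

  length≤labels*fibre : DecidableEquality B → ∀ {k} → FibresAtMost k →
    ∀ bs {xs} → Unique xs → All (λ x → label x ∈ bs) xs → length xs ≤ length bs * k
  length≤labels*fibre _ _ [] {[]} _ _ = z≤n
  length≤labels*fibre _ _ [] {_ ∷ _} _ (() ∷ _)
  length≤labels*fibre _≟_ {k} fibres (b ∷ bs) {xs} xs! labels∈ = begin
    length xs
      ≡⟨ length-filter-split P? xs ⟩
    length (filter P? xs) + length (filter (∁? P?) xs)
      ≤⟨ +-mono-≤ (fibres b (Unique.filter⁺ P? xs!) (all-filter P? xs))
                  (length≤labels*fibre _≟_ fibres bs (Unique.filter⁺ (∁? P?) xs!)
                    (All.zipWith drop-b (all-filter (∁? P?) xs , All-filter⁺ (∁? P?) labels∈))) ⟩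
    k + length bs * k ∎
    where
    open ≤-Reasoning
    P? : Decidable (λ x → label x ≡ b)
    P? x = label x ≟ b
    drop-b : ∀ {x} → label x ≢ b × label x ∈ b ∷ bs → label x ∈ bs
    drop-b (ne , here e) = ⊥-elim (ne e)
    drop-b (_ , there l∈) = l∈

count-true≤length : ∀ {n} (g : Fin n → Bool) (bs : List ℕ) →
  (∀ w → g w ≡ true → toℕ w ∈ bs) → sum (map (λ w → b2n (g w)) (allFin n)) ≤ length bs
count-true≤length {n} g bs g⇒∈ = begin
  sum (map (λ w → b2n (g w)) (allFin n))  ≡⟨ sum-b2n≡length-filter g (allFin n) ⟩
  length (filter g? (allFin n))           ≤⟨ length≤labels*fibre toℕ _≟ℕ_ toℕ-fibres≤1 bs trues! trues∈ ⟩
  length bs * 1                           ≡⟨ *-identityʳ (length bs) ⟩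
  length bs                               ∎
  where
  open ≤-Reasoning
  g? : Decidable (λ w → g w ≡ true)
  g? w = g w ≟Bool true
  toℕ-fibres≤1 : FibresAtMost toℕ 1
  toℕ-fibres≤1 = injective⇒fibresAtMost1 toℕ toℕ-injective
  trues! : Unique (filter g? (allFin n))
  trues! = Unique.filter⁺ g? (Unique.allFin⁺ n)
  trues∈ : All (λ w → toℕ w ∈ bs) (filter g? (allFin n))
  trues∈ = All.map (g⇒∈ _) (all-filter g? (allFin n))

ranked⇒acyclic : (D : Digraph) (rank : Fin (size D) → ℕ) →
  (∀ {u v} → Arc D u v → rank u < rank v) → Acyclic D
ranked⇒acyclic D rank increasing v walk = <-irrefl refl (walk-increasing walk)
  where
  walk-increasing : ∀ {u w} → Walk D u w → rank u < rank w
  walk-increasing (step a) = increasing a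
  walk-increasing (a ∷w walk) = <-trans (increasing a) (walk-increasing walk)

Reach≤1 : (D : Digraph) → Fin (size D) → Fin (size D) → Set
Reach≤1 D = ReflClosure (Arc D)

module _ {D : Digraph} where

  phyloAdj⇒commonReach : ∀ {u v} → PhyloAdj D u v → ∃ λ a → Reach≤1 D u a × Reach≤1 D v a
  phyloAdj⇒commonReach (_ , inj₁ u→v) = _ , [ u→v ] , refl
  phyloAdj⇒commonReach (_ , inj₂ (inj₁ v→u)) = _ , refl , [ v→u ]
  phyloAdj⇒commonReach (_ , inj₂ (inj₂ (w , u→w , v→w))) = w , [ u→w ] , [ v→w ]

  commonReach⇒phyloAdj : ∀ {u v a} → u ≢ v → Reach≤1 D u a → Reach≤1 D v a → PhyloAdj D u v
  commonReach⇒phyloAdj u≢v refl refl = ⊥-elim (u≢v refl)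
  commonReach⇒phyloAdj u≢v refl [ v→u ] = u≢v , inj₂ (inj₁ v→u)
  commonReach⇒phyloAdj u≢v [ u→v ] refl = u≢v , inj₁ u→v
  commonReach⇒phyloAdj u≢v [ u→w ] [ v→w ] = u≢v , inj₂ (inj₂ (_ , u→w , v→w))

TriangleFree : ∀ {ℓ} → Graph ℓ → Set
TriangleFree H = ∀ {x y z} → x ≢ y → x ≢ z → y ≢ z → H x y → H x z → H y z → ⊥

join-rim≤2*[1+outdeg] : ∀ {ℓ} {H : Graph ℓ} (D : Digraph) → TriangleFree H →
  (emb : InducedSubgraph (JoinI1 H) (PhyloAdj D)) → ℓ ≤ suc (outdeg D (proj₁ emb fz)) * 2
join-rim≤2*[1+outdeg] {ℓ} {H} D triangle-free (f , f-injective , f-induced) = begin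
  ℓ                     ≡⟨ length-tabulate (λ x → x) ⟨
  length (allFin ℓ)     ≤⟨ length≤labels*fibre anchor _≟Fin_ anchor-fibres≤2 (c ∷ out)
                             (Unique.allFin⁺ ℓ) (tabulate⁺ anchor∈) ⟩
  length (c ∷ out) * 2  ≡⟨ cong (λ d → suc d * 2) (sum-b2n≡length-filter (arc D c) (allFin (size D))) ⟨
  suc (outdeg D c) * 2  ∎
  where
  open ≤-Reasoning
  c : Fin (size D)
  c = f fz
  out : List (Fin (size D))
  out = filter (λ w → arc D c w ≟Bool true) (allFin (size D))

  meeting : ∀ x → ∃ λ a → Reach≤1 D c a × Reach≤1 D (f (fs x)) a
  meeting x = phyloAdj⇒commonReach (proj₁ (f-induced fz (fs x) (λ ())) tt)

  anchor : Fin ℓ → Fin (size D)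
  anchor x = proj₁ (meeting x)

  anchor∈ : ∀ x → anchor x ∈ c ∷ out
  anchor∈ x with meeting x
  ... | _ , refl , _ = here refl
  ... | _ , [ c→a ] , _ = there (∈-filter⁺ _ (∈-allFin _) c→a)

  same-anchor⇒adjacent : ∀ {x y} → x ≢ y → anchor x ≡ anchor y → H x y
  same-anchor⇒adjacent {x} {y} x≢y same = proj₂ (f-induced (fs x) (fs y) fx≢fy)
    (commonReach⇒phyloAdj (fx≢fy ∘ f-injective) (proj₂ (proj₂ (meeting x)))
      (subst (Reach≤1 D (f (fs y))) (sym same) (proj₂ (proj₂ (meeting y)))))
    where
    fx≢fy : fs x ≢ fs y
    fx≢fy = x≢y ∘ suc-injective

  anchor-fibres≤2 : FibresAtMost anchor 2
  anchor-fibres≤2 _ {[]} _ _ = z≤n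
  anchor-fibres≤2 _ {_ ∷ []} _ _ = s≤s z≤n
  anchor-fibres≤2 _ {_ ∷ _ ∷ []} _ _ = s≤s (s≤s z≤n)
  anchor-fibres≤2 _ {_ ∷ _ ∷ _ ∷ _} ((x≢y ∷ x≢z ∷ _) ∷ (y≢z ∷ _) ∷ _) (ax ∷ ay ∷ az ∷ _) =
    ⊥-elim (triangle-free x≢y x≢z y≢z
      (same-anchor⇒adjacent x≢y (trans ax (sym ay)))
      (same-anchor⇒adjacent x≢z (trans ax (sym az)))
      (same-anchor⇒adjacent y≢z (trans ay (sym az))))

data CycleEdge : ℕ → ℕ → ℕ → Set where
  next   : ∀ {L} a → CycleEdge L a (suc a)
  prev   : ∀ {L} a → CycleEdge L (suc a) a
  close  : ∀ a → CycleEdge (suc a) 0 a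
  close⁻ : ∀ a → CycleEdge (suc a) a 0

cycleAdj⇒edge : ∀ {ℓ} {x y : Fin ℓ} → CycleAdj ℓ x y → CycleEdge ℓ (toℕ x) (toℕ y)
cycleAdj⇒edge (inj₁ (inj₁ e)) rewrite sym e = next _
cycleAdj⇒edge (inj₁ (inj₂ e)) rewrite sym e = prev _
cycleAdj⇒edge {y = y} (inj₂ (inj₁ (x≡0 , e))) =
  subst₂ (λ L a → CycleEdge L a (toℕ y)) e (sym x≡0) (close _)
cycleAdj⇒edge {x = x} (inj₂ (inj₂ (y≡0 , e))) =
  subst₂ (λ L b → CycleEdge L (toℕ x) b) e (sym y≡0) (close⁻ _)

-- Each case is refuted by unifying the indices; a cycle of length 4 + k is too long for the
-- wrap-around edges to close a triangle.
cycleEdge-triangle-free : ∀ {k a b c} →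
  CycleEdge (4 + k) a b → CycleEdge (4 + k) a c → CycleEdge (4 + k) b c → ⊥
cycleEdge-triangle-free (next _) (next _) ()
cycleEdge-triangle-free (next _) (prev _) ()
cycleEdge-triangle-free (next _) (close _) ()
cycleEdge-triangle-free (next _) (close⁻ _) ()
cycleEdge-triangle-free (prev _) (next _) ()
cycleEdge-triangle-free (prev _) (prev _) ()
cycleEdge-triangle-free (prev _) (close⁻ _) ()
cycleEdge-triangle-free (close _) (next _) ()
cycleEdge-triangle-free (close _) (close _) ()
cycleEdge-triangle-free (close⁻ _) (next _) ()
cycleEdge-triangle-free (close⁻ _) (prev _) ()
cycleEdge-triangle-free (close⁻ _) (close⁻ _) ()

cycle-triangle-free : ∀ {ℓ} → 4 ≤ ℓ → TriangleFree (CycleAdj ℓ)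
cycle-triangle-free (s≤s (s≤s (s≤s (s≤s _)))) _ _ _ xy xz yz =
  cycleEdge-triangle-free (cycleAdj⇒edge xy) (cycleAdj⇒edge xz) (cycleAdj⇒edge yz)

path-triangle-free : ∀ {ℓ} → 4 ≤ ℓ → TriangleFree (PathAdj ℓ)
path-triangle-free 4≤ℓ x≢y x≢z y≢z xy xz yz =
  cycle-triangle-free 4≤ℓ x≢y x≢z y≢z (inj₁ xy) (inj₁ xz) (inj₁ yz)

[1+j]*2≡2*j+2 : ∀ j → suc j * 2 ≡ 2 * j + 2
[1+j]*2≡2*j+2 = solve-∀

join-rim≤2j+2 : ∀ {i j ℓ} {H : Graph ℓ} (D : Digraph) → IJDigraph i j D → TriangleFree H →
  InducedSubgraph (JoinI1 H) (PhyloAdj D) → ℓ ≤ 2 * j + 2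
join-rim≤2j+2 {j = j} D (_ , _ , outdeg≤j) triangle-free emb = begin
  _                                    ≤⟨ join-rim≤2*[1+outdeg] D triangle-free emb ⟩
  suc (outdeg D (proj₁ emb fz)) * 2    ≤⟨ *-monoˡ-≤ 2 (s≤s (outdeg≤j _)) ⟩
  suc j * 2                            ≡⟨ [1+j]*2≡2*j+2 j ⟩
  2 * j + 2                            ∎
  where open ≤-Reasoning

data Parity : ℕ → Set where
  even : ∀ t → Parity (t + t)
  odd  : ∀ t → Parity (suc (t + t))

parity : ∀ n → Parity n
parity zero = even zero
parity (suc n) with parity n
... | even t = odd t
... | odd t = subst Parity (cong suc (+-suc t t)) (even (suc t))

double-<⇒< : ∀ {t j} → t + t < j + j → t < j
double-<⇒< {t} {j} lt = ≰⇒> (λ j≤t → <⇒≱ lt (+-mono-≤ j≤t j≤t))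

<⇒2+double≤double : ∀ {t j} → t < j → 2 + (t + t) ≤ j + j
<⇒2+double≤double {t} {j} t<j = subst (_≤ j + j) (cong suc (+-suc t t)) (+-mono-≤ t<j t<j)

-- Realizes P_m ∨ I₁ (C_m ∨ I₁ when cyclic), m = 2j + 2.  Vertex 0 is an apex used only to close
-- the cycle, vertex 1 is the hub and vertex 2 + x is rim vertex x.  Rim vertices 0 and 1 meet the
-- hub in the hub itself; the hub's out-neighbours are the rim vertices 3, 5, …, m − 1, and rim
-- vertex 2t (t ≥ 1) meets the hub in rim vertex 2t + 1 through the arc along the rim.
module Construction (j′ : ℕ) (cyclic : Bool) where

  -- Writing j = 2 + j′ keeps m and suc m in constructor form, which the index unifications in
  -- the pattern matches below rely on.
  j m n : ℕ
  j = 2 + j′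
  m = 2 + (j + j)
  n = 2 + m

  hubTarget : ℕ → ℕ
  hubTarget t = 5 + (t + t)

  hubTargets : List ℕ
  hubTargets = applyUpTo hubTarget j

  data Arrow : ℕ → ℕ → Set where
    rim₀→hub     : Arrow 2 1
    rim₁→hub     : Arrow 3 1
    hub→rim      : ∀ t → t < j → Arrow 1 (hubTarget t)
    rim→rim      : ∀ v → 3 ≤ v → v ≤ m → Arrow v (suc v)
    rim₀→apex    : cyclic ≡ true → Arrow 2 0
    rimLast→apex : cyclic ≡ true → Arrow (suc m) 0

  ArrowSpec : ℕ → ℕ → Set
  ArrowSpec u w = ((u ≡ 2 ⊎ u ≡ 3) × w ≡ 1)
                ⊎ (u ≡ 1 × w ∈ hubTargets)
                ⊎ (3 ≤ u × u ≤ m × w ≡ suc u)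
                ⊎ (cyclic ≡ true × (u ≡ 2 ⊎ u ≡ suc m) × w ≡ 0)

  spec⇒arrow : ∀ {u w} → ArrowSpec u w → Arrow u w
  spec⇒arrow (inj₁ (inj₁ refl , refl)) = rim₀→hub
  spec⇒arrow (inj₁ (inj₂ refl , refl)) = rim₁→hub
  spec⇒arrow (inj₂ (inj₁ (refl , w∈))) with ∈-applyUpTo⁻ hubTarget w∈
  ... | t , t<j , refl = hub→rim t t<j
  spec⇒arrow (inj₂ (inj₂ (inj₁ (3≤u , u≤m , refl)))) = rim→rim _ 3≤u u≤m
  spec⇒arrow (inj₂ (inj₂ (inj₂ (c , inj₁ refl , refl)))) = rim₀→apex c
  spec⇒arrow (inj₂ (inj₂ (inj₂ (c , inj₂ refl , refl)))) = rimLast→apex c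

  arrow⇒spec : ∀ {u w} → Arrow u w → ArrowSpec u w
  arrow⇒spec rim₀→hub = inj₁ (inj₁ refl , refl)
  arrow⇒spec rim₁→hub = inj₁ (inj₂ refl , refl)
  arrow⇒spec (hub→rim t t<j) = inj₂ (inj₁ (refl , ∈-applyUpTo⁺ hubTarget t<j))
  arrow⇒spec (rim→rim _ 3≤v v≤m) = inj₂ (inj₂ (inj₁ (3≤v , v≤m , refl)))
  arrow⇒spec (rim₀→apex c) = inj₂ (inj₂ (inj₂ (c , inj₁ refl , refl)))
  arrow⇒spec (rimLast→apex c) = inj₂ (inj₂ (inj₂ (c , inj₂ refl , refl)))

  arrow? : ∀ u w → Dec (Arrow u w)
  arrow? u w = map′ spec⇒arrow arrow⇒spec
    (((u ≟ℕ 2 ⊎-dec u ≟ℕ 3) ×-dec w ≟ℕ 1)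
    ⊎-dec (u ≟ℕ 1 ×-dec w ∈? hubTargets)
    ⊎-dec (3 ≤? u ×-dec u ≤? m ×-dec w ≟ℕ suc u)
    ⊎-dec (cyclic ≟Bool true ×-dec (u ≟ℕ 2 ⊎-dec u ≟ℕ suc m) ×-dec w ≟ℕ 0))

  D : Digraph
  D = record { size = n ; arc = λ u w → does (arrow? (toℕ u) (toℕ w)) }

  arc-sound : ∀ u w → Arc D u w → Arrow (toℕ u) (toℕ w)
  arc-sound u w u→w = invert (subst (Reflects _) u→w (proof (arrow? (toℕ u) (toℕ w))))

  arc-complete : ∀ {u w} → Arrow (toℕ u) (toℕ w) → Arc D u w
  arc-complete {u} {w} = dec-true (arrow? (toℕ u) (toℕ w))

  rank : ℕ → ℕ
  rank 0 = n
  rank 1 = 2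
  rank 2 = 0
  rank 3 = 1
  rank v@(suc (suc (suc (suc _)))) = v

  rank-increases : ∀ {u w} → Arrow u w → rank u < rank w
  rank-increases rim₀→hub = s≤s z≤n
  rank-increases rim₁→hub = s≤s (s≤s z≤n)
  rank-increases (hub→rim _ _) = s≤s (s≤s (s≤s z≤n))
  rank-increases (rim→rim _ (s≤s (s≤s (s≤s (z≤n {0})))) _) = s≤s (s≤s z≤n)
  rank-increases (rim→rim _ (s≤s (s≤s (s≤s (z≤n {suc _})))) _) = n<1+n _
  rank-increases (rim₀→apex _) = s≤s z≤n
  rank-increases (rimLast→apex _) = ≤-refl

  outCandidates : ℕ → List ℕ
  outCandidates 0 = []
  outCandidates 1 = hubTargets
  outCandidates 2 = 1 ∷ 0 ∷ []
  outCandidates 3 = 1 ∷ 4 ∷ []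
  outCandidates v@(suc (suc (suc (suc _)))) = suc v ∷ 0 ∷ []

  outCandidates-length : ∀ u → length (outCandidates u) ≤ j
  outCandidates-length 0 = z≤n
  outCandidates-length 1 = ≤-reflexive (length-applyUpTo hubTarget j)
  outCandidates-length 2 = s≤s (s≤s z≤n)
  outCandidates-length 3 = s≤s (s≤s z≤n)
  outCandidates-length (suc (suc (suc (suc _)))) = s≤s (s≤s z≤n)

  arrow⇒∈outCandidates : ∀ {u w} → Arrow u w → w ∈ outCandidates u
  arrow⇒∈outCandidates rim₀→hub = here refl
  arrow⇒∈outCandidates rim₁→hub = here refl
  arrow⇒∈outCandidates (hub→rim t t<j) = ∈-applyUpTo⁺ hubTarget t<j
  arrow⇒∈outCandidates (rim→rim _ (s≤s (s≤s (s≤s (z≤n {0})))) _) = there (here refl)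
  arrow⇒∈outCandidates (rim→rim _ (s≤s (s≤s (s≤s (z≤n {suc _})))) _) = here refl
  arrow⇒∈outCandidates (rim₀→apex _) = there (here refl)
  arrow⇒∈outCandidates (rimLast→apex _) = there (here refl)

  inCandidates : ℕ → List ℕ
  inCandidates 0 = 2 ∷ suc m ∷ []
  inCandidates 1 = 2 ∷ 3 ∷ []
  inCandidates (suc (suc w)) = 1 ∷ suc w ∷ []

  inCandidates-length : ∀ w → length (inCandidates w) ≤ 2
  inCandidates-length 0 = ≤-refl
  inCandidates-length 1 = ≤-refl
  inCandidates-length (suc (suc _)) = ≤-refl

  arrow⇒∈inCandidates : ∀ {u w} → Arrow u w → u ∈ inCandidates w
  arrow⇒∈inCandidates rim₀→hub = here refl
  arrow⇒∈inCandidates rim₁→hub = there (here refl)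
  arrow⇒∈inCandidates (hub→rim _ _) = here refl
  arrow⇒∈inCandidates (rim→rim _ (s≤s (s≤s (s≤s z≤n))) _) = there (here refl)
  arrow⇒∈inCandidates (rim₀→apex _) = here refl
  arrow⇒∈inCandidates (rimLast→apex _) = there (here refl)

  D-is-IJ : ∀ i → 2 ≤ i → IJDigraph i j D
  D-is-IJ i 2≤i =
    ranked⇒acyclic D (rank ∘ toℕ) (λ {u} {w} → rank-increases ∘ arc-sound u w) , indeg≤i , outdeg≤j
    where
    indeg≤i : ∀ w → indeg D w ≤ i
    indeg≤i w = ≤-trans
      (count-true≤length (λ u → arc D u w) (inCandidates (toℕ w)) (λ u → arrow⇒∈inCandidates ∘ arc-sound u w))
      (≤-trans (inCandidates-length (toℕ w)) 2≤i)
    outdeg≤j : ∀ u → outdeg D u ≤ j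
    outdeg≤j u = ≤-trans
      (count-true≤length (arc D u) (outCandidates (toℕ u)) (λ w → arrow⇒∈outCandidates ∘ arc-sound u w))
      (outCandidates-length (toℕ u))

  Reach : ℕ → ℕ → Set
  Reach = ReflClosure Arrow

  Meet : ℕ → ℕ → Set
  Meet u v = ∃ λ a → a < n × Reach u a × Reach v a

  meet-sym : ∀ {u v} → Meet u v → Meet v u
  meet-sym (a , a<n , ru , rv) = a , a<n , rv , ru

  hub-meets-rim : ∀ y → y < m → Meet 1 (2 + y)
  hub-meets-rim 0 _ = 1 , s≤s (s≤s z≤n) , refl , [ rim₀→hub ]
  hub-meets-rim 1 _ = 1 , s≤s (s≤s z≤n) , refl , [ rim₁→hub ]
  hub-meets-rim (suc (suc s)) (s≤s (s≤s s<j+j)) with parity s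
  ... | even t =
    hubTarget t , s≤s (s≤s (s≤s (s≤s 2+2t≤j+j))) ,
    [ hub→rim t t<j ] , [ rim→rim _ (s≤s (s≤s (s≤s z≤n))) (s≤s (s≤s 2+2t≤j+j)) ]
    where
    t<j : t < j
    t<j = double-<⇒< s<j+j
    2+2t≤j+j : 2 + (t + t) ≤ j + j
    2+2t≤j+j = <⇒2+double≤double t<j
  ... | odd t =
    hubTarget t , s≤s (s≤s (s≤s (s≤s (<⇒2+double≤double t<j)))) , [ hub→rim t t<j ] , refl
    where
    t<j : t < j
    t<j = double-<⇒< (<-trans (n<1+n _) s<j+j)

  rim-meets-next : ∀ y → suc y < m → Meet (2 + y) (3 + y)
  rim-meets-next 0 _ = 1 , s≤s (s≤s z≤n) , [ rim₀→hub ] , [ rim₁→hub ]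
  rim-meets-next (suc y) 2+y<m =
    4 + y , s≤s (s≤s 2+y<m) , [ rim→rim _ (s≤s (s≤s (s≤s z≤n))) 2+y<m ] , refl

  ends-meet : cyclic ≡ true → Meet 2 (suc m)
  ends-meet c = 0 , s≤s z≤n , [ rim₀→apex c ] , [ rimLast→apex c ]

  RimAdj : ℕ → ℕ → Set
  RimAdj x y = (suc x ≡ y ⊎ suc y ≡ x)
             ⊎ (cyclic ≡ true × ((x ≡ 0 × suc y ≡ m) ⊎ (y ≡ 0 × suc x ≡ m)))

  common-target⇒rimAdj : ∀ {x y a} → x ≢ y → Arrow (2 + x) a → Arrow (2 + y) a → RimAdj x y
  common-target⇒rimAdj x≢y rim₀→hub rim₀→hub = ⊥-elim (x≢y refl)
  common-target⇒rimAdj _ rim₀→hub rim₁→hub = inj₁ (inj₁ refl)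
  common-target⇒rimAdj _ rim₁→hub rim₀→hub = inj₁ (inj₂ refl)
  common-target⇒rimAdj x≢y rim₁→hub rim₁→hub = ⊥-elim (x≢y refl)
  common-target⇒rimAdj x≢y (rim→rim _ _ _) (rim→rim _ _ _) = ⊥-elim (x≢y refl)
  common-target⇒rimAdj x≢y (rim₀→apex _) (rim₀→apex _) = ⊥-elim (x≢y refl)
  common-target⇒rimAdj _ (rim₀→apex c) (rimLast→apex _) = inj₂ (c , inj₁ (refl , refl))
  common-target⇒rimAdj _ (rimLast→apex c) (rim₀→apex _) = inj₂ (c , inj₂ (refl , refl))
  common-target⇒rimAdj x≢y (rimLast→apex _) (rimLast→apex _) = ⊥-elim (x≢y refl)

  meet⇒rimAdj : ∀ {x y a} → x ≢ y → Reach (2 + x) a → Reach (2 + y) a → RimAdj x y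
  meet⇒rimAdj x≢y refl refl = ⊥-elim (x≢y refl)
  meet⇒rimAdj _ refl [ rim→rim _ _ _ ] = inj₁ (inj₂ refl)
  meet⇒rimAdj _ [ rim→rim _ _ _ ] refl = inj₁ (inj₁ refl)
  meet⇒rimAdj x≢y [ x→a ] [ y→a ] = common-target⇒rimAdj x≢y x→a y→a

  reach-sound : ∀ {u w} → Reach≤1 D u w → Reach (toℕ u) (toℕ w)
  reach-sound = Refl.map (λ {u} {w} → arc-sound u w)

  reach-complete : ∀ {u a} (a<n : a < n) → Reach (toℕ u) a → Reach≤1 D u (fromℕ< a<n)
  reach-complete {u} a<n refl = subst (Reach≤1 D u) (sym (fromℕ<-toℕ u a<n)) refl
  reach-complete {u} a<n [ u→a ] =
    [ arc-complete (subst (Arrow (toℕ u)) (sym (toℕ-fromℕ< a<n)) u→a) ]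

  meet⇒phyloAdj : ∀ {u v} → u ≢ v → Meet (toℕ u) (toℕ v) → PhyloAdj D u v
  meet⇒phyloAdj u≢v (_ , a<n , ru , rv) =
    commonReach⇒phyloAdj u≢v (reach-complete a<n ru) (reach-complete a<n rv)

  phyloAdj⇒rimAdj : ∀ {p q : Fin m} → p ≢ q →
    PhyloAdj D (fs (fs p)) (fs (fs q)) → RimAdj (toℕ p) (toℕ q)
  phyloAdj⇒rimAdj p≢q adj with phyloAdj⇒commonReach adj
  ... | _ , rp , rq = meet⇒rimAdj (p≢q ∘ toℕ-injective) (reach-sound rp) (reach-sound rq)

  join-embeds : (G : Graph m) →
    (∀ {p q} → G p q → Meet (2 + toℕ p) (2 + toℕ q)) →
    (∀ {p q} → p ≢ q → RimAdj (toℕ p) (toℕ q) → G p q) →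
    InducedSubgraph (JoinI1 G) (PhyloAdj D)
  join-embeds G meet back = fs , suc-injective , induced
    where
    induced : ∀ a b → a ≢ b →
      (JoinI1 G a b → PhyloAdj D (fs a) (fs b)) × (PhyloAdj D (fs a) (fs b) → JoinI1 G a b)
    induced fz fz a≢b = ⊥-elim (a≢b refl)
    induced fz (fs q) _ =
      const (meet⇒phyloAdj (λ ()) (hub-meets-rim (toℕ q) (toℕ<n q))) , const tt
    induced (fs p) fz _ =
      const (meet⇒phyloAdj (λ ()) (meet-sym (hub-meets-rim (toℕ p) (toℕ<n p)))) , const tt
    induced (fs p) (fs q) fp≢fq =
      meet⇒phyloAdj (fp≢fq ∘ suc-injective) ∘ meet , back p≢q ∘ phyloAdj⇒rimAdj p≢q
      where
      p≢q : p ≢ q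
      p≢q = fp≢fq ∘ cong fs

  path-meet : ∀ {p q} → PathAdj m p q → Meet (2 + toℕ p) (2 + toℕ q)
  path-meet {p} {q} (inj₁ e) =
    subst (λ k → Meet _ (2 + k)) e (rim-meets-next (toℕ p) (subst (_< m) (sym e) (toℕ<n q)))
  path-meet {p} {q} (inj₂ e) =
    meet-sym (subst (λ k → Meet _ (2 + k)) e (rim-meets-next (toℕ q) (subst (_< m) (sym e) (toℕ<n p))))

2*j+2≡2+[j+j] : ∀ j → 2 * j + 2 ≡ 2 + (j + j)
2*j+2≡2+[j+j] = solve-∀

fan-realizable : ∀ i j → 2 ≤ i → 2 ≤ j → Realizable i j (Fan (2 * j + 2))
fan-realizable i _ 2≤i (s≤s (s≤s (z≤n {j′}))) =
  subst (λ k → Realizable i j (Fan k)) (sym (2*j+2≡2+[j+j] j))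
    (D , D-is-IJ i 2≤i , join-embeds (PathAdj m) path-meet back)
  where
  open Construction j′ false
  back : ∀ {p q} → p ≢ q → RimAdj (toℕ p) (toℕ q) → PathAdj m p q
  back _ (inj₁ adj) = adj
  back _ (inj₂ (() , _))

wheel-realizable : ∀ i j → 2 ≤ i → 2 ≤ j → Realizable i j (Wheel (2 * j + 2))
wheel-realizable i _ 2≤i (s≤s (s≤s (z≤n {j′}))) =
  subst (λ k → Realizable i j (Wheel k)) (sym (2*j+2≡2+[j+j] j))
    (D , D-is-IJ i 2≤i , join-embeds (CycleAdj m) meet back)
  where
  open Construction j′ true
  meet : ∀ {p q} → CycleAdj m p q → Meet (2 + toℕ p) (2 + toℕ q)
  meet (inj₁ adj) = path-meet adj
  meet (inj₂ (inj₁ (p≡0 , 1+q≡m))) =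
    subst₂ Meet (cong (2 +_) (sym p≡0)) (cong suc (sym 1+q≡m)) (ends-meet refl)
  meet (inj₂ (inj₂ (q≡0 , 1+p≡m))) =
    meet-sym (subst₂ Meet (cong (2 +_) (sym q≡0)) (cong suc (sym 1+p≡m)) (ends-meet refl))
  back : ∀ {p q} → p ≢ q → RimAdj (toℕ p) (toℕ q) → CycleAdj m p q
  back _ (inj₁ adj) = inj₁ adj
  back _ (inj₂ (_ , ends)) = inj₂ ends

fan-or-wheel-bound : ∀ {i j} ℓ (D : Digraph) → 2 ≤ j → IJDigraph i j D →
  InducedSubgraph (Fan ℓ) (PhyloAdj D) ⊎ InducedSubgraph (Wheel ℓ) (PhyloAdj D) → ℓ ≤ 2 * j + 2
fan-or-wheel-bound ℓ D 2≤j ij emb with ℓ ≤? 3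
... | yes ℓ≤3 = ≤-trans ℓ≤3 (≤-trans 3≤6 (+-monoˡ-≤ 2 (*-monoʳ-≤ 2 2≤j)))
  where
  3≤6 : 3 ≤ 6
  3≤6 = s≤s (s≤s (s≤s z≤n))
... | no ℓ≰3 with emb
...   | inj₁ fan = join-rim≤2j+2 D ij (path-triangle-free (≰⇒> ℓ≰3)) fan
...   | inj₂ wheel = join-rim≤2j+2 D ij (cycle-triangle-free (≰⇒> ℓ≰3)) wheel

proposition3p7 : (i j : ℕ) → 2 ≤ i → 2 ≤ j →
    ((ℓ : ℕ) → 1 ≤ ℓ → (D : Digraph) → IJDigraph i j D →
      (InducedSubgraph (Fan ℓ) (PhyloAdj D) ⊎ InducedSubgraph (Wheel ℓ) (PhyloAdj D)) →
      ℓ ≤ 2 * j + 2)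
    × Realizable i j (Fan (2 * j + 2))
    × Realizable i j (Wheel (2 * j + 2))
proposition3p7 i j 2≤i 2≤j =
    (λ ℓ _ D ij → fan-or-wheel-bound ℓ D 2≤j ij)
  , fan-realizable i j 2≤i 2≤j
  , wheel-realizable i j 2≤i 2≤j
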